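{- Let $G=(V,E)$ be a graph, $a,b\in V$, $k$ a positive integer, and suppose $C_G(b)<C_G(a)$. Then at least one of the following holds: (i) $C_{G+ab}(b)<C_{G+ab}(a)$; (ii) $R_{G+ab}(a,b)\ge\frac{6}{11}$; (iii) $R_G(a,b)\ge\frac{6}{11}$.
   Context: All graphs are finite, simple, undirected, unweighted and connected. $d_G(u,v)$ is the shortest-path distance, $C_G(v)=\sum_{u\in V}d_G(u,v)$ is the closeness centrality of $v$, and $R_G(a,b)=\frac{\min(C_G(a),C_G(b))}{\max(C_G(a),C_G(b))}$ is the closeness ratio. $G+ab$ denotes the graph obtained from $G$ by adding the edge $ab$ (equal to $G$ if $ab\in E$). -}

module Defs where

open import Data.Nat using (ℕ; zero; suc; _+_; _*_; _≤_; _<_; _⊔_; _⊓_)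
open import Data.Fin using (Fin; _≟_)
open import Data.Bool using (Bool; true; false; _∨_; _∧_; if_then_else_)
open import Data.List using (List; map; allFin)
open import Data.Nat.ListAction using (sum)
open import Data.Bool.ListAction using (any)
open import Data.Product using (∃)
open import Relation.Binary.PropositionalEquality using (_≡_)
open import Relation.Nullary.Decidable using (⌊_⌋)

Adj : ℕ → Set
Adj n = Fin n → Fin n → Bool

data Walk {n : ℕ} (A : Adj n) : Fin n → Fin n → ℕ → Set where
  nil  : ∀ {u} → Walk A u u 0
  cons : ∀ {u w v k} → A u w ≡ true → Walk A w v k → Walk A u v (suc k)

record Graph (n : ℕ) : Set where
  field
    adj       : Adj n
    symmetric : ∀ u v → adj u v ≡ adj v u
    loopless  : ∀ u → adj u u ≡ false
    connected : ∀ u v → ∃ λ k → Walk adj u v k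
open Graph public

reach : ∀ {n} → Adj n → ℕ → Fin n → Fin n → Bool
reach A zero    u v = ⌊ u ≟ v ⌋
reach A (suc k) u v = reach A k u v ∨ any (λ w → A u w ∧ reach A k w v) (allFin _)

distFrom : ∀ {n} → Adj n → Fin n → Fin n → ℕ → ℕ → ℕ
distFrom A u v zero     k = k
distFrom A u v (suc f)  k = if reach A k u v then k else distFrom A u v f (suc k)

-- Shortest-path distance d(u,v): the least k with a walk of length ≤ k.
-- (In a connected graph on n vertices d(u,v) ≤ n - 1, so fuel n suffices.)
dist : ∀ {n} → Adj n → Fin n → Fin n → ℕ
dist {n} A u v = distFrom A u v n 0

closeness : ∀ {n} → Adj n → Fin n → ℕ
closeness A v = sum (map (λ u → dist A u v) (allFin _))

addEdge : ∀ {n} → Adj n → Fin n → Fin n → Adj n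
addEdge A a b u v = A u v ∨ (⌊ u ≟ a ⌋ ∧ ⌊ v ≟ b ⌋) ∨ (⌊ u ≟ b ⌋ ∧ ⌊ v ≟ a ⌋)

-- R(a,b) ≥ p/q  where R(a,b) = min(C a, C b) / max(C a, C b),
-- written cross-multiplied:  p * max ≤ q * min.
RatioAtLeast : ∀ {n} → Adj n → Fin n → Fin n → ℕ → ℕ → Set
RatioAtLeast A a b p q =
  p * (closeness A a ⊔ closeness A b) ≤ q * (closeness A a ⊓ closeness A b)

{-# OPTIONS --safe #-}
-- Suppose all three alternatives fail, and write d, d′ for distances in G and G + ab, C, C′ for
-- closeness, D = d(a,b). Then 11 C(b) < 6 C(a) and 11 C′(a) < 6 C′(b). But every vertex u satisfies
--   6 d(u,a) + 6D d′(u,b) ≤ 11 d(u,b) + 11D d′(u,a),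
-- an arithmetic consequence of the triangle inequality, d′(u,b) ≤ min(d(u,b), d(u,a) + 1) and
-- d′(u,a) ≥ min(d(u,a), d(u,b) + 1). Summing over u contradicts the two strict inequalities.
module Submission where

open import Defs
open import Data.Nat using (ℕ; _<_; _≤_)
open import Data.Fin using (Fin)
open import Data.Sum using (_⊎_)

open import Data.Bool using (true; false; T; _∧_)
open import Data.Bool.Properties using (T-≡; T-∨; T-∧; ∨-zeroʳ)
open import Data.Empty using (⊥; ⊥-elim)
open import Data.Fin using (_≟_)
open import Data.List using ([]; _∷_; map; allFin)
open import Data.List.Membership.Propositional using (lose)
open import Data.List.Membership.Propositional.Properties using (∈-allFin)
open import Data.List.Relation.Unary.Any using (satisfied)
open import Data.List.Relation.Unary.Any.Properties using (any⁺; any⁻)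
open import Data.Nat using (suc; zero; _+_; _*_; _⊓_; z≤n; s≤s; _≤?_; _<?_)
open import Data.Nat.ListAction using (sum)
open import Data.Nat.Properties hiding (_≟_)
open import Data.Nat.Tactic.RingSolver using (solve)
open import Data.Product using (_×_; _,_; ∃-syntax)
open import Data.Sum using (inj₁; inj₂)
open import Function.Bundles using (module Equivalence)
open import Relation.Binary.PropositionalEquality
open import Relation.Nullary using (¬_; Dec; yes; no)
open import Relation.Nullary.Decidable using (⌊_⌋; toWitness; fromWitness; dec-yes-recompute)

open Equivalence using (to; from)

module _ {n : ℕ} (A : Adj n) where

  reach⇒walk : ∀ k u v → T (reach A k u v) → ∃[ j ] j ≤ k × Walk A u v j
  reach⇒walk zero    u v r with toWitness r
  ... | refl = 0 , z≤n , nil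
  reach⇒walk (suc k) u v r with to T-∨ r
  ... | inj₁ r′ = let j , j≤k , p = reach⇒walk k u v r′ in j , m≤n⇒m≤1+n j≤k , p
  ... | inj₂ r′ =
    let w , uw∧wv = satisfied (any⁻ _ (allFin n) r′)
        uw , wv = to T-∧ uw∧wv
        j , j≤k , p = reach⇒walk k w v wv
    in suc j , s≤s j≤k , cons (to T-≡ uw) p

  walk⇒reach : ∀ {u v j} k → Walk A u v j → j ≤ k → T (reach A k u v)
  walk⇒reach zero    nil _ = fromWitness refl
  walk⇒reach (suc k) nil _ = from T-∨ (inj₁ (walk⇒reach k nil z≤n))
  walk⇒reach (suc k) (cons {w = w} uw p) (s≤s j≤k) =
    from T-∨ (inj₂ (any⁺ _ (lose (∈-allFin w) (from T-∧ (from T-≡ uw , walk⇒reach k p j≤k)))))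

  distFrom-≤ : ∀ u v f k → distFrom A u v f k ≤ f + k
  distFrom-≤ u v zero    k = ≤-refl
  distFrom-≤ u v (suc f) k with reach A k u v
  ... | true  = m≤n+m k (suc f)
  ... | false = ≤-trans (distFrom-≤ u v f (suc k)) (≤-reflexive (+-suc f k))

  distFrom-attained : ∀ u v f k → distFrom A u v f k ≡ f + k ⊎ T (reach A (distFrom A u v f k) u v)
  distFrom-attained u v zero    k = inj₁ refl
  distFrom-attained u v (suc f) k with reach A k u v in eq
  ... | true  = inj₂ (from T-≡ eq)
  ... | false with distFrom-attained u v f (suc k)
  ...   | inj₁ d≡f+1+k = inj₁ (trans d≡f+1+k (+-suc f k))
  ...   | inj₂ r       = inj₂ r

  distFrom-least : ∀ u v f {k j} → k ≤ j → T (reach A j u v) → distFrom A u v f k ≤ j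
  distFrom-least u v zero    k≤j _ = k≤j
  distFrom-least u v (suc f) {k} k≤j r with reach A k u v in eq
  ... | true  = k≤j
  ... | false with m≤n⇒m<n∨m≡n k≤j
  ...   | inj₁ k<j  = distFrom-least u v f k<j r
  ...   | inj₂ refl = ⊥-elim (subst T eq r)

  dist≤n : ∀ u v → dist A u v ≤ n
  dist≤n u v = ≤-trans (distFrom-≤ u v n 0) (≤-reflexive (+-identityʳ n))

  -- When no walk is found within the fuel, dist returns the junk value n. Every lemma below
  -- also holds for that value, so connectivity of the graph is never needed.
  dist-attained : ∀ u v → dist A u v ≡ n ⊎ ∃[ j ] j ≤ dist A u v × Walk A u v j
  dist-attained u v with distFrom-attained u v n 0
  ... | inj₁ d≡n+0 = inj₁ (trans d≡n+0 (+-identityʳ n))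
  ... | inj₂ r     = inj₂ (reach⇒walk _ u v r)

  dist-≤-walk : ∀ {u v j} → Walk A u v j → dist A u v ≤ j
  dist-≤-walk {u} {v} p = distFrom-least u v n z≤n (walk⇒reach _ p ≤-refl)

  dist-refl : ∀ u → dist A u u ≡ 0
  dist-refl u = n≤0⇒n≡0 (dist-≤-walk nil)

  dist-edge : ∀ {u w} → A u w ≡ true → dist A u w ≤ 1
  dist-edge uw = dist-≤-walk (cons uw nil)

  _++ʷ_ : ∀ {u v w i j} → Walk A u v i → Walk A v w j → Walk A u w (i + j)
  nil       ++ʷ q = q
  cons uw p ++ʷ q = cons uw (p ++ʷ q)

  dist-triangle : ∀ u v w → dist A u w ≤ dist A u v + dist A v w
  dist-triangle u v w with dist-attained u v | dist-attained v w
  ... | inj₁ uv≡n | _ rewrite uv≡n = ≤-trans (dist≤n u w) (m≤m+n n _)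
  ... | inj₂ _ | inj₁ vw≡n rewrite vw≡n = ≤-trans (dist≤n u w) (m≤n+m n _)
  ... | inj₂ (i , i≤ , p) | inj₂ (j , j≤ , q) = ≤-trans (dist-≤-walk (p ++ʷ q)) (+-mono-≤ i≤ j≤)

  dist-edge-step : ∀ {u w} v → A u w ≡ true → dist A u v ≤ suc (dist A w v)
  dist-edge-step {u} {w} v uw = ≤-trans (dist-triangle u w v) (+-monoˡ-≤ (dist A w v) (dist-edge uw))

  potential≤dist : ∀ {v} (f : Fin n → ℕ) → f v ≡ 0 → (∀ {u w} → A u w ≡ true → f u ≤ suc (f w)) →
    (∀ u → f u ≤ n) → ∀ u → f u ≤ dist A u v
  potential≤dist {v} f f[v]≡0 f-edge f≤n u with dist-attained u v
  ... | inj₁ uv≡n = subst (f u ≤_) (sym uv≡n) (f≤n u)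
  ... | inj₂ (j , j≤ , p) = ≤-trans (bounded p) j≤
    where
    bounded : ∀ {u j} → Walk A u v j → f u ≤ j
    bounded nil         = ≤-reflexive f[v]≡0
    bounded (cons uw p) = ≤-trans (f-edge uw) (s≤s (bounded p))

dist-antitone : ∀ {n} {A B : Adj n} → (∀ {u w} → A u w ≡ true → B u w ≡ true) →
  ∀ u v → dist B u v ≤ dist A u v
dist-antitone {A = A} {B} A⊆B u v =
  potential≤dist A (λ x → dist B x v) (dist-refl B v) (λ xw → dist-edge-step B v (A⊆B xw)) (λ x → dist≤n B x v) u

dist-sym-≤ : ∀ {n} (G : Graph n) u v → dist (adj G) v u ≤ dist (adj G) u v
dist-sym-≤ G u v = potential≤dist A (dist A v) (dist-refl A v) step (dist≤n A v) u
  where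
  A = adj G
  step : ∀ {x w} → A x w ≡ true → dist A v x ≤ suc (dist A v w)
  step {x} {w} xw = begin
    dist A v x              ≤⟨ dist-triangle A v w x ⟩
    dist A v w + dist A w x ≤⟨ +-monoʳ-≤ (dist A v w) (dist-edge A (trans (symmetric G w x) xw)) ⟩
    dist A v w + 1          ≡⟨ +-comm (dist A v w) 1 ⟩
    suc (dist A v w)        ∎
    where open ≤-Reasoning

dist-sym : ∀ {n} (G : Graph n) u v → dist (adj G) u v ≡ dist (adj G) v u
dist-sym G u v = ≤-antisym (dist-sym-≤ G v u) (dist-sym-≤ G u v)

module _ {n} (A : Adj n) (a b : Fin n) where

  addEdge-⊇ : ∀ {u w} → A u w ≡ true → addEdge A a b u w ≡ true
  addEdge-⊇ uw rewrite uw = refl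

  addEdge-new : addEdge A a b a b ≡ true
  addEdge-new rewrite dec-yes-recompute (a ≟ a) refl | dec-yes-recompute (b ≟ b) refl = ∨-zeroʳ (A a b)

  addEdge-cases : ∀ {u w} → addEdge A a b u w ≡ true → A u w ≡ true ⊎ (u ≡ a × w ≡ b) ⊎ (u ≡ b × w ≡ a)
  addEdge-cases {u} {w} uw with to (T-∨ {A u w}) (from T-≡ uw)
  ... | inj₁ old = inj₁ (to T-≡ old)
  ... | inj₂ new with to (T-∨ {⌊ u ≟ a ⌋ ∧ ⌊ w ≟ b ⌋}) new
  ...   | inj₁ ab = let u≡a , w≡b = to (T-∧ {⌊ u ≟ a ⌋}) ab in inj₂ (inj₁ (toWitness u≡a , toWitness w≡b))
  ...   | inj₂ ba = let u≡b , w≡a = to (T-∧ {⌊ u ≟ b ⌋}) ba in inj₂ (inj₂ (toWitness u≡b , toWitness w≡a))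

  -- min(d(x,a), 1 + d(x,b)) still drops by at most one along every edge of G + ab: the new edge
  -- b → a goes from a vertex where it is at most 1 to a, where it is 0.
  addEdge-dist-≥ : ∀ u → dist A u a ⊓ suc (dist A u b) ≤ dist (addEdge A a b) u a
  addEdge-dist-≥ = potential≤dist (addEdge A a b) f f[a]≡0 f-edge f≤n
    where
    f : Fin n → ℕ
    f x = dist A x a ⊓ suc (dist A x b)
    f[a]≡0 : f a ≡ 0
    f[a]≡0 rewrite dist-refl A a = refl
    f≤n : ∀ x → f x ≤ n
    f≤n x = ≤-trans (m⊓n≤m _ _) (dist≤n A x a)
    f-edge : ∀ {x w} → addEdge A a b x w ≡ true → f x ≤ suc (f w)
    f-edge xw with addEdge-cases xw
    ... | inj₁ old = ⊓-mono-≤ (dist-edge-step A a old) (s≤s (dist-edge-step A b old))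
    ... | inj₂ (inj₁ (refl , refl)) = ≤-trans (≤-reflexive f[a]≡0) z≤n
    ... | inj₂ (inj₂ (refl , refl)) = ≤-trans (m⊓n≤n _ _) (s≤s (≤-reflexive (trans (dist-refl A b) (sym f[a]≡0))))

six-eleven-bound-near : ∀ {x y D x′ y′} → 1 ≤ x → x ≤ y → D ≤ x + y → y′ ≤ suc x → x ≤ x′ →
  6 * x + 6 * D * y′ ≤ 11 * y + 11 * D * x′
six-eleven-bound-near {x} {y} {D} {x′} {y′} 1≤x x≤y D≤x+y y′≤1+x x≤x′ = begin
  6 * x + 6 * D * y′                         ≤⟨ +-monoʳ-≤ (6 * x) (*-monoʳ-≤ (6 * D) y′≤1+x) ⟩
  6 * x + 6 * D * suc x                      ≡⟨ solve (x ∷ D ∷ []) ⟩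
  6 * x + D + 5 * (D * 1) + 6 * D * x
    ≤⟨ +-monoˡ-≤ (6 * D * x) (+-mono-≤ (+-mono-≤ (*-monoʳ-≤ 6 x≤y) D≤2y) (*-monoʳ-≤ 5 (*-monoʳ-≤ D 1≤x))) ⟩
  6 * y + 2 * y + 5 * (D * x) + 6 * D * x    ≤⟨ m≤m+n _ (3 * y) ⟩
  6 * y + 2 * y + 5 * (D * x) + 6 * D * x + 3 * y ≡⟨ solve (x ∷ y ∷ D ∷ []) ⟩
  11 * y + 11 * D * x                        ≤⟨ +-monoʳ-≤ (11 * y) (*-monoʳ-≤ (11 * D) x≤x′) ⟩
  11 * y + 11 * D * x′                       ∎
  where
  open ≤-Reasoning
  D≤2y : D ≤ 2 * y
  D≤2y = begin
    D      ≤⟨ D≤x+y ⟩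
    x + y  ≤⟨ +-monoˡ-≤ y x≤y ⟩
    y + y  ≡⟨ solve (y ∷ []) ⟩
    2 * y  ∎

-- x, y stand for d(u,a), d(u,b) in G, x′, y′ for the same distances in G + ab, and D for d(a,b).
six-eleven-bound : ∀ {x y D x′ y′} → x ≤ y + D → D ≤ x + y → y′ ≤ y → y′ ≤ suc x → x ⊓ suc y ≤ x′ →
  6 * x + 6 * D * y′ ≤ 11 * y + 11 * D * x′
six-eleven-bound {x} {y} x≤y+D D≤x+y y′≤y y′≤1+x x⊓1+y≤x′ with ≤-<-connex x y
six-eleven-bound {zero} {y} {D} {x′} {y′} _ D≤y _ y′≤1 _ | inj₁ _ = begin
  6 * D * y′             ≤⟨ *-monoʳ-≤ (6 * D) y′≤1 ⟩
  6 * D * 1              ≡⟨ *-identityʳ (6 * D) ⟩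
  6 * D                  ≤⟨ *-monoʳ-≤ 6 D≤y ⟩
  6 * y                  ≤⟨ *-monoˡ-≤ y (m≤m+n 6 5) ⟩
  11 * y                 ≤⟨ m≤m+n (11 * y) _ ⟩
  11 * y + 11 * D * x′   ∎
  where open ≤-Reasoning
six-eleven-bound {suc _} {x′ = x′} _ D≤x+y _ y′≤1+x x⊓1+y≤x′ | inj₁ x≤y =
  six-eleven-bound-near (s≤s z≤n) x≤y D≤x+y y′≤1+x (subst (_≤ x′) (m≤n⇒m⊓n≡m (m≤n⇒m≤1+n x≤y)) x⊓1+y≤x′)
six-eleven-bound {x} {y} {D} {x′} {y′} x≤y+D _ y′≤y _ x⊓1+y≤x′ | inj₂ y<x = begin
  6 * x + 6 * D * y′                ≤⟨ +-mono-≤ (*-monoʳ-≤ 6 x≤y+D) (*-monoʳ-≤ (6 * D) y′≤y) ⟩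
  6 * (y + D) + 6 * D * y           ≤⟨ m≤m+n _ (5 * y + 5 * D * suc y) ⟩
  6 * (y + D) + 6 * D * y + (5 * y + 5 * D * suc y) ≡⟨ solve (y ∷ D ∷ []) ⟩
  11 * y + 11 * D * suc y           ≤⟨ +-monoʳ-≤ (11 * y) (*-monoʳ-≤ (11 * D) (subst (_≤ x′) (m≥n⇒m⊓n≡n y<x) x⊓1+y≤x′)) ⟩
  11 * y + 11 * D * x′              ∎
  where open ≤-Reasoning

sum-map-mono : ∀ {B : Set} {f g : B → ℕ} → (∀ x → f x ≤ g x) → ∀ xs → sum (map f xs) ≤ sum (map g xs)
sum-map-mono f≤g []       = z≤n
sum-map-mono f≤g (x ∷ xs) = +-mono-≤ (f≤g x) (sum-map-mono f≤g xs)

sum-map-linear : ∀ {B : Set} p q (f g : B → ℕ) xs →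
  sum (map (λ x → p * f x + q * g x) xs) ≡ p * sum (map f xs) + q * sum (map g xs)
sum-map-linear p q f g []       = solve (p ∷ q ∷ [])
sum-map-linear p q f g (x ∷ xs) = begin
  p * f x + q * g x + sum (map (λ x → p * f x + q * g x) xs)
    ≡⟨ cong (p * f x + q * g x +_) (sum-map-linear p q f g xs) ⟩
  p * f x + q * g x + (p * sum (map f xs) + q * sum (map g xs))
    ≡⟨ regroup (f x) (g x) (sum (map f xs)) (sum (map g xs)) ⟩
  p * (f x + sum (map f xs)) + q * (g x + sum (map g xs))
    ∎
  where
  open ≡-Reasoning
  regroup : ∀ m n m′ n′ → p * m + q * n + (p * m′ + q * n′) ≡ p * (m + m′) + q * (n + n′)
  regroup m n m′ n′ = solve (p ∷ q ∷ m ∷ n ∷ m′ ∷ n′ ∷ [])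

p*x≤q*y⇒p*d*x≤q*d*y : ∀ p q d {x y} → p * x ≤ q * y → p * d * x ≤ q * d * y
p*x≤q*y⇒p*d*x≤q*d*y p q d {x} {y} px≤qy = begin
  p * d * x    ≡⟨ solve (p ∷ d ∷ x ∷ []) ⟩
  d * (p * x)  ≤⟨ *-monoʳ-≤ d px≤qy ⟩
  d * (q * y)  ≡⟨ solve (q ∷ d ∷ y ∷ []) ⟩
  q * d * y    ∎
  where open ≤-Reasoning

module _ {n} (A : Adj n) (a b : Fin n) (p q : ℕ) where

  ratioAtLeast? : Dec (RatioAtLeast A a b p q)
  ratioAtLeast? = _ ≤? _

  ¬RatioAtLeast⇒< : closeness A b ≤ closeness A a → ¬ RatioAtLeast A a b p q →
    q * closeness A b < p * closeness A a
  ¬RatioAtLeast⇒< Cb≤Ca ¬r rewrite m≥n⇒m⊔n≡m Cb≤Ca | m≥n⇒m⊓n≡n Cb≤Ca = ≰⇒> ¬r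

  ¬RatioAtLeast⇒<′ : closeness A a ≤ closeness A b → ¬ RatioAtLeast A a b p q →
    q * closeness A a < p * closeness A b
  ¬RatioAtLeast⇒<′ Ca≤Cb ¬r rewrite m≤n⇒m⊔n≡n Ca≤Cb | m≤n⇒m⊓n≡m Ca≤Cb = ≰⇒> ¬r

module _ {n} (G : Graph n) (a b : Fin n) where

  private
    A A′ : Adj n
    A  = adj G
    A′ = addEdge A a b
    D : ℕ
    D  = dist A a b

  addEdge-dist-balance : ∀ u →
    6 * dist A u a + 6 * D * dist A′ u b ≤ 11 * dist A u b + 11 * D * dist A′ u a
  addEdge-dist-balance u = six-eleven-bound ua≤ub+D D≤ua+ub (dist-antitone (addEdge-⊇ A a b) u b) ub′≤1+ua
    (addEdge-dist-≥ A a b u)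
    where
    open ≤-Reasoning
    ua≤ub+D : dist A u a ≤ dist A u b + D
    ua≤ub+D = begin
      dist A u a               ≤⟨ dist-triangle A u b a ⟩
      dist A u b + dist A b a  ≡⟨ cong (dist A u b +_) (dist-sym G b a) ⟩
      dist A u b + D           ∎
    D≤ua+ub : D ≤ dist A u a + dist A u b
    D≤ua+ub = begin
      D                        ≤⟨ dist-triangle A a u b ⟩
      dist A a u + dist A u b  ≡⟨ cong (_+ dist A u b) (dist-sym G a u) ⟩
      dist A u a + dist A u b  ∎
    ub′≤1+ua : dist A′ u b ≤ suc (dist A u a)
    ub′≤1+ua = begin
      dist A′ u b                ≤⟨ dist-triangle A′ u a b ⟩
      dist A′ u a + dist A′ a b  ≤⟨ +-mono-≤ (dist-antitone (addEdge-⊇ A a b) u a) (dist-edge A′ (addEdge-new A a b)) ⟩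
      dist A u a + 1             ≡⟨ +-comm (dist A u a) 1 ⟩
      suc (dist A u a)           ∎

  addEdge-closeness-balance :
    6 * closeness A a + 6 * D * closeness A′ b ≤ 11 * closeness A b + 11 * D * closeness A′ a
  addEdge-closeness-balance = subst₂ _≤_
    (sum-map-linear 6 (6 * D) (λ u → dist A u a) (λ u → dist A′ u b) (allFin n))
    (sum-map-linear 11 (11 * D) (λ u → dist A u b) (λ u → dist A′ u a) (allFin n))
    (sum-map-mono addEdge-dist-balance (allFin n))

  ratios-not-both-below-6/11 : closeness A b < closeness A a → closeness A′ a ≤ closeness A′ b →
    ¬ RatioAtLeast A′ a b 6 11 → ¬ RatioAtLeast A a b 6 11 → ⊥
  ratios-not-both-below-6/11 Cb<Ca Ca′≤Cb′ ¬r′ ¬r =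
    <⇒≱ (+-mono-<-≤ 11Cb<6Ca 11DCa′≤6DCb′) addEdge-closeness-balance
    where
    11Cb<6Ca : 11 * closeness A b < 6 * closeness A a
    11Cb<6Ca = ¬RatioAtLeast⇒< A a b 6 11 (<⇒≤ Cb<Ca) ¬r
    11DCa′≤6DCb′ : 11 * D * closeness A′ a ≤ 6 * D * closeness A′ b
    11DCa′≤6DCb′ = p*x≤q*y⇒p*d*x≤q*d*y 11 6 D (<⇒≤ (¬RatioAtLeast⇒<′ A′ a b 6 11 Ca′≤Cb′ ¬r′))

lemma1 : ∀ {n} (G : Graph n) (a b : Fin n) (k : ℕ) → 1 ≤ k →
    closeness (adj G) b < closeness (adj G) a →
    (closeness (addEdge (adj G) a b) b < closeness (addEdge (adj G) a b) a)
    ⊎ RatioAtLeast (addEdge (adj G) a b) a b 6 11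
    ⊎ RatioAtLeast (adj G) a b 6 11
lemma1 G a b _ _ Cb<Ca
  with closeness (addEdge (adj G) a b) b <? closeness (addEdge (adj G) a b) a
     | ratioAtLeast? (addEdge (adj G) a b) a b 6 11
     | ratioAtLeast? (adj G) a b 6 11
... | yes Cb′<Ca′ | _      | _     = inj₁ Cb′<Ca′
... | no _        | yes r′ | _     = inj₂ (inj₁ r′)
... | no _        | no _   | yes r = inj₂ (inj₂ r)
... | no Cb′≮Ca′  | no ¬r′ | no ¬r = ⊥-elim (ratios-not-both-below-6/11 G a b Cb<Ca (≮⇒≥ Cb′≮Ca′) ¬r′ ¬r)
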